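{- Let $\mathcal{A}\subseteq{\bf\Sigma}^0_1(\mathcal{N})$. (1) $L(\mathcal{A})$ is an upper semilattice in which every countable non-empty subset has a supremum. (2) $L^\ast_\bot(\mathcal{A})$ is a distributive upper semilattice in which every countable non-empty subset has a supremum.
   Context: $\mathcal{N}=\omega^\omega$ is the Baire space and ${\bf\Sigma}^0_1(\mathcal{N})$ its set of open subsets. A ${\bf\Sigma}^0_1$-TR is a map $\nu:\mathcal{N}\to{\bf\Sigma}^0_1(\mathcal{N})$ with $\{(a,x)\mid x\in\nu(a)\}$ open in $\mathcal{N}\times\mathcal{N}$. $\mu\leq\nu$ iff $\mu=\nu\circ f$ for a continuous $f$ on $\mathcal{N}$. $\mathcal{L}(\mathcal{A})$ is the set of ${\bf\Sigma}^0_1$-TRs with range exactly $\mathcal{A}$, $\mathcal{L}^\ast(\mathcal{A})$ the set of ${\bf\Sigma}^0_1$-TRs with range contained in $\mathcal{A}$; $L(\mathcal{A})$, $L^\ast(\mathcal{A})$ are the quotient posets of $(\mathcal{L}(\mathcal{A});\leq)$, $(\mathcal{L}^\ast(\mathcal{A});\leq)$, and $L^\ast_\bot(\mathcal{A})$ is $L^\ast(\mathcal{A})$ with a new least element $\bot$ adjoined. An upper semilattice is distributive if $x\leq y\vee z$ implies $x=y_1\vee z_1$ for some $y_1\leq y$, $z_1\leq z$. -}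

module Defs where

open import Level using (Level; _⊔_) renaming (suc to lsuc)
open import Data.Nat using (ℕ; _<_)
open import Data.Product using (Σ; _×_; _,_)
open import Data.Maybe using (Maybe; just; nothing)
open import Data.Empty using (⊥)
open import Data.Unit using (⊤)
open import Relation.Binary.PropositionalEquality using (_≡_)

Baire : Set
Baire = ℕ → ℕ

Agree : ℕ → Baire → Baire → Set
Agree n x y = ∀ i → i < n → x i ≡ y i

Subset : Set₁
Subset = Baire → Set

IsOpen : Subset → Set
IsOpen U = ∀ x → U x → Σ ℕ λ n → ∀ y → Agree n x y → U y

_≐_ : Subset → Subset → Set
U ≐ V = ∀ x → (U x → V x) × (V x → U x)

Family : Set₂
Family = Subset → Set₁

FamilyOfOpen : Family → Set₁
FamilyOfOpen 𝒜 = ∀ U → 𝒜 U → IsOpen U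

_∈F_ : Subset → Family → Set₁
U ∈F 𝒜 = Σ Subset λ V → 𝒜 V × (V ≐ U)

IsContinuous : (Baire → Baire) → Set
IsContinuous f = ∀ x n → Σ ℕ λ m → ∀ y → Agree m x y → Agree n (f x) (f y)

-- Σ⁰₁-TRs: ν : 𝒩 → Σ⁰₁(𝒩) with {(a,x) | x ∈ ν a} open in 𝒩 × 𝒩

IsTR : (Baire → Subset) → Set
IsTR ν = ∀ a x → ν a x →
  Σ ℕ λ n → ∀ b y → Agree n a b → Agree n x y → ν b y

record TR : Set₁ where
  constructor mkTR
  field
    rep  : Baire → Subset
    isTR : IsTR rep
open TR public

_≤TR_ : TR → TR → Set
μ ≤TR ν = Σ (Baire → Baire) λ f →
  IsContinuous f × (∀ a → rep μ a ≐ rep ν (f a))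

RangeIn : Family → TR → Set₁
RangeIn 𝒜 ν = ∀ a → rep ν a ∈F 𝒜

RangeExactly : Family → TR → Set₁
RangeExactly 𝒜 ν = RangeIn 𝒜 ν × (∀ U → 𝒜 U → Σ Baire λ a → rep ν a ≐ U)

𝓛 : Family → Set₁
𝓛 𝒜 = Σ TR (RangeExactly 𝒜)

𝓛* : Family → Set₁
𝓛* 𝒜 = Σ TR (RangeIn 𝒜)

_≤L_ : ∀ {𝒜} → 𝓛 𝒜 → 𝓛 𝒜 → Set
(μ , _) ≤L (ν , _) = μ ≤TR ν

_≤L*_ : ∀ {𝒜} → 𝓛* 𝒜 → 𝓛* 𝒜 → Set
(μ , _) ≤L* (ν , _) = μ ≤TR ν

-- L*_⊥(𝒜): nothing = the new least element ⊥
𝓛*⊥ : Family → Set₁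
𝓛*⊥ 𝒜 = Maybe (𝓛* 𝒜)

_≤⊥_ : ∀ {𝒜} → 𝓛*⊥ 𝒜 → 𝓛*⊥ 𝒜 → Set
nothing ≤⊥ _       = ⊤
just _  ≤⊥ nothing = ⊥
just μ  ≤⊥ just ν  = μ ≤L* ν

-- Order-theoretic notions for a preorder R on A, read in the quotient
-- poset (suprema are unique up to the equivalence induced by R).

module _ {a r : Level} {A : Set a} (R : A → A → Set r) where

  IsJoin : A → A → A → Set (a ⊔ r)
  IsJoin x y j = R x j × R y j × (∀ w → R x w → R y w → R j w)

  -- supremum of the countable non-empty subset {s i | i ∈ ℕ}
  IsSup : (ℕ → A) → A → Set (a ⊔ r)
  IsSup s j = (∀ i → R (s i) j) × (∀ w → (∀ i → R (s i) w) → R j w)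

  IsUpperSemilattice : Set (a ⊔ r)
  IsUpperSemilattice = ∀ x y → Σ A (IsJoin x y)

  HasCountableSups : Set (a ⊔ r)
  HasCountableSups = ∀ (s : ℕ → A) → Σ A (IsSup s)

  IsDistributive : Set (a ⊔ r)
  IsDistributive = ∀ x y z j → IsJoin y z j → R x j →
    Σ A λ y₁ → Σ A λ z₁ → R y₁ y × R z₁ z × IsJoin y₁ z₁ x

-- Suprema are disjoint sums: the sum ⨁ s of a sequence of TRs reads the index
-- from the first entry of a code and the code of s i from the rest, and any
-- family of continuous reductions s i ≤ ν glues into one reduction ⨁ s ≤ ν
-- because the first entry splits 𝒩 into clopen pieces. This needs no
-- hypothesis on 𝒜 and gives (1) and the joins of L*(𝒜).
-- Distributivity: if μ ≤ α ⊕ β via f, the codes a with f a 0 = 0 form a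
-- clopen set. If it or its complement is empty, μ lies below α or below β
-- (the other component being ⊥). Otherwise, pick a₀ in it and a₁ outside; the
-- continuous maps retracting 𝒩 onto either piece turn μ into Y ≤ α and
-- Z ≤ β, and μ is recovered from Y and Z by the same case split, so μ is their
-- join. Deciding emptiness, and whether a sequence in L*_⊥(𝒜) is constantly
-- ⊥, is where excluded middle enters.
module Submission where

open import Defs
open import Level using (0ℓ)
open import Axiom.ExcludedMiddle using (ExcludedMiddle)
open import Function using (id; _∘_)
open import Data.Nat using (ℕ; zero; suc; _≤_; s≤s; z≤n; _⊔_; _≟_)
open import Data.Nat.Properties
  using (n≤1+n; m≤m⊔n; m≤n⊔m; ≤-trans; <-≤-trans; 1+n≢0)
open import Data.Product using (Σ; _×_; _,_; proj₁; proj₂)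
open import Data.Maybe using (just; nothing; fromMaybe)
open import Data.Empty using (⊥-elim)
open import Data.Unit using (tt)
open import Relation.Nullary using (¬_; yes; no)
open import Relation.Nullary.Decidable using (decidable-stable)
open import Relation.Binary.PropositionalEquality
  using (_≡_; _≢_; refl; sym; trans; cong; subst)

cons : ℕ → Baire → Baire
cons k a zero    = k
cons k a (suc i) = a i

tail : Baire → Baire
tail a i = a (suc i)

Agree-weaken : ∀ {m n x y} → m ≤ n → Agree n x y → Agree m x y
Agree-weaken m≤n x≈y i i<m = x≈y i (<-≤-trans i<m m≤n)

Agree-head : ∀ {n x y} → Agree (suc n) x y → x 0 ≡ y 0
Agree-head x≈y = x≈y 0 (s≤s z≤n)

Agree-tail : ∀ {n x y} → Agree (suc n) x y → Agree n (tail x) (tail y)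
Agree-tail x≈y i i<n = x≈y (suc i) (s≤s i<n)

Agree-cons : ∀ {n x y} k → Agree n x y → Agree n (cons k x) (cons k y)
Agree-cons k x≈y zero    _   = refl
Agree-cons k x≈y (suc i) i<n = x≈y i (≤-trans (n≤1+n (suc i)) i<n)

branch : ∀ {a} {A : Set a} → ℕ → A → A → A
branch zero    x y = x
branch (suc _) x y = y

branch-elim : ∀ {a p} {A : Set a} (P : A → Set p) {x y : A} →
  P x → P y → ∀ k → P (branch k x y)
branch-elim P px py zero    = px
branch-elim P px py (suc _) = py

branch-nonzero : ∀ {a} {A : Set a} {k} {x y : A} → k ≢ 0 → branch k x y ≡ y
branch-nonzero {k = zero}  k≢0 = ⊥-elim (k≢0 refl)
branch-nonzero {k = suc _} _   = refl

branch-zero : ∀ {a} {A : Set a} {k} {x y : A} → k ≡ 0 → branch k x y ≡ x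
branch-zero refl = refl

Agree-branch : ∀ {n a b c d} k →
  Agree n a b → Agree n c d → Agree n (branch k a c) (branch k b d)
Agree-branch zero    a≈b _   = a≈b
Agree-branch (suc _) _   c≈d = c≈d

id-continuous : IsContinuous id
id-continuous x n = n , λ y x≈y → x≈y

const-continuous : ∀ c → IsContinuous (λ _ → c)
const-continuous c x n = 0 , λ y _ i _ → refl

∘-continuous : ∀ {f g} → IsContinuous f → IsContinuous g → IsContinuous (g ∘ f)
∘-continuous {f} cf cg x n with cg (f x) n
... | m , fx≈ with cf x m
... | l , x≈ = l , λ y x≈y → fx≈ (f y) (x≈ y x≈y)

cons-continuous : ∀ k → IsContinuous (cons k)
cons-continuous k x n = n , λ y x≈y → Agree-cons k x≈y

tail-continuous : IsContinuous tail
tail-continuous x n = suc n , λ y x≈y → Agree-tail x≈y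

branch-continuous : ∀ {f g h} →
  IsContinuous f → IsContinuous g → IsContinuous h →
  IsContinuous (λ a → branch (f a 0) (g a) (h a))
branch-continuous {f} {g} {h} cf cg ch x n
  with cf x 1 | cg x n | ch x n
... | l , f≈ | m₁ , g≈ | m₂ , h≈ = l ⊔ (m₁ ⊔ m₂) , agree
  where
  agree : ∀ y → Agree (l ⊔ (m₁ ⊔ m₂)) x y →
    Agree n (branch (f x 0) (g x) (h x)) (branch (f y 0) (g y) (h y))
  agree y x≈y
    rewrite Agree-head (f≈ y (Agree-weaken (m≤m⊔n l _) x≈y)) =
    Agree-branch (f y 0)
      (g≈ y (Agree-weaken (≤-trans (m≤m⊔n m₁ m₂) (m≤n⊔m l _)) x≈y))
      (h≈ y (Agree-weaken (≤-trans (m≤n⊔m m₁ m₂) (m≤n⊔m l _)) x≈y))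

≐-refl : ∀ {U} → U ≐ U
≐-refl x = id , id

≐-reflexive : ∀ {U V} → U ≡ V → U ≐ V
≐-reflexive refl = ≐-refl

≐-trans : ∀ {U V W} → U ≐ V → V ≐ W → U ≐ W
≐-trans U≐V V≐W x =
  (proj₁ (V≐W x) ∘ proj₁ (U≐V x)) , (proj₂ (U≐V x) ∘ proj₂ (V≐W x))

≤TR-refl : ∀ μ → μ ≤TR μ
≤TR-refl μ = id , id-continuous , λ a → ≐-refl

≤TR-trans : ∀ {μ ν ρ} → μ ≤TR ν → ν ≤TR ρ → μ ≤TR ρ
≤TR-trans (f , cf , μ≐) (g , cg , ν≐) =
  g ∘ f , ∘-continuous cf cg , λ a → ≐-trans (μ≐ a) (ν≐ (f a))

precompose : (ν : TR) (f : Baire → Baire) → IsContinuous f → TR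
precompose ν f cf = mkTR (λ a → rep ν (f a)) isTR-∘
  where
  isTR-∘ : IsTR (λ a → rep ν (f a))
  isTR-∘ a x x∈ with isTR ν (f a) x x∈
  ... | n , nbhd with cf a n
  ... | m , fa≈ = n ⊔ m , λ b y a≈b x≈y →
    nbhd (f b) y (fa≈ b (Agree-weaken (m≤n⊔m n m) a≈b))
      (Agree-weaken (m≤m⊔n n m) x≈y)

precompose-≤ : ∀ ν f cf → precompose ν f cf ≤TR ν
precompose-≤ ν f cf = f , cf , λ a → ≐-refl

⨁ : (ℕ → TR) → TR
⨁ s = mkTR (λ a → rep (s (a 0)) (tail a)) isTR-⨁
  where
  isTR-⨁ : IsTR (λ a → rep (s (a 0)) (tail a))
  isTR-⨁ a x x∈ with isTR (s (a 0)) (tail a) x x∈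
  ... | n , nbhd = suc n , λ b y a≈b x≈y →
    subst (λ i → rep (s i) (tail b) y) (Agree-head a≈b)
      (nbhd (tail b) y (Agree-tail a≈b) (Agree-weaken (n≤1+n n) x≈y))

⨁-upper : ∀ s i → s i ≤TR ⨁ s
⨁-upper s i = cons i , cons-continuous i , λ a → ≐-refl

⨁-least : ∀ s ν → (∀ i → s i ≤TR ν) → ⨁ s ≤TR ν
⨁-least s ν s≤ν =
  glued , glued-continuous , λ a → proj₂ (proj₂ (s≤ν (a 0))) (tail a)
  where
  glued : Baire → Baire
  glued a = proj₁ (s≤ν (a 0)) (tail a)
  glued-continuous : IsContinuous glued
  glued-continuous x n with proj₁ (proj₂ (s≤ν (x 0))) (tail x) n
  ... | m , tx≈ = suc m , agree
    where
    agree : ∀ y → Agree (suc m) x y → Agree n (glued x) (glued y)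
    agree y x≈y rewrite sym (Agree-head x≈y) = tx≈ (tail y) (Agree-tail x≈y)

⨁-isSup : ∀ s → IsSup _≤TR_ s (⨁ s)
⨁-isSup s = ⨁-upper s , ⨁-least s

isSup⇒isJoin : ∀ {a r} {A : Set a} (R : A → A → Set r) {x y j : A} →
  IsSup R (λ i → branch i x y) j → IsJoin R x y j
isSup⇒isJoin R (upper , least) =
  upper 0 , upper 1 , λ w x≤w y≤w → least w (branch-elim (λ v → R v w) x≤w y≤w)

_⊕_ : TR → TR → TR
α ⊕ β = ⨁ (λ i → branch i α β)

⊕-isJoin : ∀ α β → IsJoin _≤TR_ α β (α ⊕ β)
⊕-isJoin α β =
  isSup⇒isJoin _≤TR_ {x = α} {y = β} {j = α ⊕ β} (⨁-isSup (λ i → branch i α β))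

factor-through-summand : ∀ μ s ν f → IsContinuous f →
  (∀ a → rep μ a ≐ rep (⨁ s) (f a)) → (∀ a → s (f a 0) ≡ ν) → μ ≤TR ν
factor-through-summand μ s ν f cf μ≐ s≡ν =
  tail ∘ f , ∘-continuous cf tail-continuous ,
  λ a → ≐-trans (μ≐ a) (≐-reflexive (cong (λ T → rep T (tail (f a))) (s≡ν a)))

module BelowBinarySum (μ α β : TR) (f : Baire → Baire) (cf : IsContinuous f)
  (μ≐ : ∀ a → rep μ a ≐ rep (α ⊕ β) (f a)) where

  factor-left : ∀ r (cr : IsContinuous r) → (∀ a → f (r a) 0 ≡ 0) →
    precompose μ r cr ≤TR α
  factor-left r cr left =
    factor-through-summand (precompose μ r cr) (λ i → branch i α β) α (f ∘ r)
    (∘-continuous cr cf) (μ≐ ∘ r) (λ a → branch-zero (left a))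

  factor-right : ∀ r (cr : IsContinuous r) → (∀ a → f (r a) 0 ≢ 0) →
    precompose μ r cr ≤TR β
  factor-right r cr right =
    factor-through-summand (precompose μ r cr) (λ i → branch i α β) β (f ∘ r)
    (∘-continuous cr cf) (μ≐ ∘ r) (λ a → branch-nonzero (right a))

  module Retractions (a₀ a₁ : Baire) where

    retract-left : Baire → Baire
    retract-left a = branch (f a 0) a a₀

    retract-right : Baire → Baire
    retract-right a = branch (f a 0) a₁ a

    retract-left-continuous : IsContinuous retract-left
    retract-left-continuous =
      branch-continuous cf id-continuous (const-continuous a₀)

    retract-right-continuous : IsContinuous retract-right
    retract-right-continuous =
      branch-continuous cf (const-continuous a₁) id-continuous

    retract-left-hits-left : f a₀ 0 ≡ 0 → ∀ a → f (retract-left a) 0 ≡ 0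
    retract-left-hits-left fa₀≡0 a with f a 0 in eq
    ... | zero  = eq
    ... | suc _ = fa₀≡0

    retract-right-hits-right : f a₁ 0 ≢ 0 → ∀ a → f (retract-right a) 0 ≢ 0
    retract-right-hits-right fa₁≢0 a with f a 0 in eq
    ... | zero  = fa₁≢0
    ... | suc _ = λ fa≡0 → 1+n≢0 (trans (sym eq) fa≡0)

    μ-left : TR
    μ-left = precompose μ retract-left retract-left-continuous

    μ-right : TR
    μ-right = precompose μ retract-right retract-right-continuous

    glue : ∀ {ν} → μ-left ≤TR ν → μ-right ≤TR ν → μ ≤TR ν
    glue {ν} (g , cg , left≐) (h , ch , right≐) =
      (λ a → branch (f a 0) (g a) (h a)) , branch-continuous cf cg ch ,
      λ a → glue-rep (f a 0) (left≐ a) (right≐ a)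
      where
      glue-rep : ∀ {a x y} k → rep μ (branch k a a₀) ≐ rep ν x →
        rep μ (branch k a₁ a) ≐ rep ν y → rep μ a ≐ rep ν (branch k x y)
      glue-rep zero    left _  = left
      glue-rep (suc _) _ right = right

module _ {P : TR → Set₁} where

  _≤ₚ_ : Σ TR P → Σ TR P → Set
  x ≤ₚ y = proj₁ x ≤TR proj₁ y

  isSup-restrict : ∀ s j (pj : P j) → IsSup _≤TR_ (proj₁ ∘ s) j → IsSup _≤ₚ_ s (j , pj)
  isSup-restrict s j pj (upper , least) = upper , λ w → least (proj₁ w)

  isJoin-restrict : ∀ x y j (pj : P j) →
    IsJoin _≤TR_ (proj₁ x) (proj₁ y) j → IsJoin _≤ₚ_ x y (j , pj)
  isJoin-restrict x y j pj (x≤j , y≤j , least) = x≤j , y≤j , λ w → least (proj₁ w)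

module _ (𝒜 : Family) where

  infix 4 _≤ᴸ_ _≤*_ _⊑_

  _≤ᴸ_ : 𝓛 𝒜 → 𝓛 𝒜 → Set
  _≤ᴸ_ = _≤L_

  _≤*_ : 𝓛* 𝒜 → 𝓛* 𝒜 → Set
  _≤*_ = _≤L*_

  _⊑_ : 𝓛*⊥ 𝒜 → 𝓛*⊥ 𝒜 → Set
  _⊑_ = _≤⊥_

  ⨁-rangeIn : ∀ s → (∀ i → RangeIn 𝒜 (s i)) → RangeIn 𝒜 (⨁ s)
  ⨁-rangeIn s ranges a = ranges (a 0) (tail a)

  ⨁-rangeExactly : ∀ s → (∀ i → RangeExactly 𝒜 (s i)) → RangeExactly 𝒜 (⨁ s)
  ⨁-rangeExactly s ranges = ⨁-rangeIn s (proj₁ ∘ ranges) , onto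
    where
    onto : ∀ U → 𝒜 U → Σ Baire λ a → rep (⨁ s) a ≐ U
    onto U U∈ with proj₂ (ranges 0) U U∈
    ... | a , a↦U = cons 0 a , a↦U

  ⊕-rangeIn : ∀ α β → RangeIn 𝒜 α → RangeIn 𝒜 β → RangeIn 𝒜 (α ⊕ β)
  ⊕-rangeIn α β rα rβ =
    ⨁-rangeIn (λ i → branch i α β) (branch-elim (RangeIn 𝒜) rα rβ)

  ⊕-rangeExactly : ∀ α β → RangeExactly 𝒜 α → RangeExactly 𝒜 β →
    RangeExactly 𝒜 (α ⊕ β)
  ⊕-rangeExactly α β rα rβ =
    ⨁-rangeExactly (λ i → branch i α β) (branch-elim (RangeExactly 𝒜) rα rβ)

  precompose-rangeIn : ∀ ν f cf → RangeIn 𝒜 ν → RangeIn 𝒜 (precompose ν f cf)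
  precompose-rangeIn ν f cf rν = rν ∘ f

  𝓛-join : ∀ x y → Σ (𝓛 𝒜) (IsJoin _≤ᴸ_ x y)
  𝓛-join (α , rα) (β , rβ) =
    (α ⊕ β , rαβ) , isJoin-restrict (α , rα) (β , rβ) (α ⊕ β) rαβ (⊕-isJoin α β)
    where rαβ = ⊕-rangeExactly α β rα rβ

  𝓛-sup : ∀ s → Σ (𝓛 𝒜) (IsSup _≤ᴸ_ s)
  𝓛-sup s =
    (⨁ (proj₁ ∘ s) , r) , isSup-restrict s (⨁ (proj₁ ∘ s)) r (⨁-isSup (proj₁ ∘ s))
    where r = ⨁-rangeExactly (proj₁ ∘ s) (proj₂ ∘ s)

  _⊕*_ : 𝓛* 𝒜 → 𝓛* 𝒜 → 𝓛* 𝒜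
  (α , rα) ⊕* (β , rβ) = α ⊕ β , ⊕-rangeIn α β rα rβ

  ⊕*-isJoin : ∀ x y → IsJoin _≤*_ x y (x ⊕* y)
  ⊕*-isJoin x y =
    isJoin-restrict x y (proj₁ x ⊕ proj₁ y) (proj₂ (x ⊕* y)) (⊕-isJoin (proj₁ x) (proj₁ y))

  ⨁* : (ℕ → 𝓛* 𝒜) → 𝓛* 𝒜
  ⨁* s = ⨁ (proj₁ ∘ s) , ⨁-rangeIn (proj₁ ∘ s) (proj₂ ∘ s)

  ⨁*-isSup : ∀ s → IsSup _≤*_ s (⨁* s)
  ⨁*-isSup s =
    isSup-restrict s (⨁ (proj₁ ∘ s)) (proj₂ (⨁* s)) (⨁-isSup (proj₁ ∘ s))

  ≤⊥-refl : ∀ x → x ⊑ x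
  ≤⊥-refl nothing  = tt
  ≤⊥-refl (just x) = ≤TR-refl (proj₁ x)

  ≤⊥-trans : ∀ x y z → x ⊑ y → y ⊑ z → x ⊑ z
  ≤⊥-trans nothing  _        _        _   _   = tt
  ≤⊥-trans (just x) (just y) (just z) x≤y y≤z =
    ≤TR-trans {proj₁ x} {proj₁ y} {proj₁ z} x≤y y≤z

  isJoin-⊥ˡ : ∀ x → IsJoin _⊑_ nothing x x
  isJoin-⊥ˡ x = tt , ≤⊥-refl x , λ w _ x≤w → x≤w

  isJoin-⊥ʳ : ∀ x → IsJoin _⊑_ x nothing x
  isJoin-⊥ʳ x = ≤⊥-refl x , tt , λ w x≤w _ → x≤w

  𝓛*⊥-join : ∀ x y → Σ (𝓛*⊥ 𝒜) (IsJoin _⊑_ x y)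
  𝓛*⊥-join nothing  y        = y , isJoin-⊥ˡ y
  𝓛*⊥-join (just x) nothing  = just x , isJoin-⊥ʳ (just x)
  𝓛*⊥-join (just x) (just y) = just (x ⊕* y) , x≤j , y≤j , least
    where
    x≤j = proj₁ (⊕*-isJoin x y)
    y≤j = proj₁ (proj₂ (⊕*-isJoin x y))
    least : ∀ w → just x ⊑ w → just y ⊑ w → just (x ⊕* y) ⊑ w
    least (just w) = proj₂ (proj₂ (⊕*-isJoin x y)) w

  fromMaybe-upper : ∀ d x t → fromMaybe d x ≤* t → x ⊑ just t
  fromMaybe-upper d nothing  t _   = tt
  fromMaybe-upper d (just x) t x≤t = x≤t

  fromMaybe-least : ∀ d x t → d ≤* t → x ⊑ just t → fromMaybe d x ≤* t
  fromMaybe-least d nothing  t d≤t _   = d≤t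
  fromMaybe-least d (just x) t _   x≤t = x≤t

  ⋢⊥⇒just : ∀ x → ¬ (x ⊑ nothing) → Σ (𝓛* 𝒜) λ v → x ≡ just v
  ⋢⊥⇒just nothing  x≰⊥ = ⊥-elim (x≰⊥ tt)
  ⋢⊥⇒just (just v) _   = v , refl

  -- The ⊥ entries are replaced by a fixed non-⊥ entry d of the sequence,
  -- which does not change the upper bounds.
  𝓛*⊥-sup : ExcludedMiddle 0ℓ → ∀ s → Σ (𝓛*⊥ 𝒜) (IsSup _⊑_ s)
  𝓛*⊥-sup em s with em {Σ ℕ λ i → ¬ (s i ⊑ nothing)}
  ... | no all-⊥ =
    nothing , (λ i → decidable-stable em λ sᵢ≰⊥ → all-⊥ (i , sᵢ≰⊥)) , λ w _ → tt
  ... | yes (i₀ , sᵢ₀≰⊥) with ⋢⊥⇒just (s i₀) sᵢ₀≰⊥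
  ... | d , sᵢ₀≡d = just (⨁* filled) , upper , least
    where
    filled : ℕ → 𝓛* 𝒜
    filled i = fromMaybe d (s i)
    upper : ∀ i → s i ⊑ just (⨁* filled)
    upper i = fromMaybe-upper d (s i) _ (proj₁ (⨁*-isSup filled) i)
    d≤ : ∀ w → s i₀ ⊑ w → just d ⊑ w
    d≤ w rewrite sᵢ₀≡d = id
    least : ∀ w → (∀ i → s i ⊑ w) → just (⨁* filled) ⊑ w
    least nothing  s≤w = d≤ nothing (s≤w i₀)
    least (just w) s≤w = proj₂ (⨁*-isSup filled) w
      λ i → fromMaybe-least d (s i) w (d≤ (just w) (s≤w i₀)) (s≤w i)

  split-below-⊕* : ExcludedMiddle 0ℓ → ∀ μ α β → μ ≤* (α ⊕* β) →
    Σ (𝓛*⊥ 𝒜) λ y₁ → Σ (𝓛*⊥ 𝒜) λ z₁ →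
      y₁ ⊑ just α × z₁ ⊑ just β × IsJoin _⊑_ y₁ z₁ (just μ)
  split-below-⊕* em (μ , rμ) (α , _) (β , _) (f , cf , μ≐)
    with em {Σ Baire λ a → f a 0 ≡ 0} | em {Σ Baire λ a → f a 0 ≢ 0}
  ... | no none-left | _ =
    nothing , just (μ , rμ) , tt ,
    factor-right id id-continuous (λ a fa≡0 → none-left (a , fa≡0)) ,
    isJoin-⊥ˡ (just (μ , rμ))
    where open BelowBinarySum μ α β f cf μ≐
  ... | yes _ | no none-right =
    just (μ , rμ) , nothing ,
    factor-left id id-continuous
      (λ a → decidable-stable (f a 0 ≟ 0) λ fa≢0 → none-right (a , fa≢0)) ,
    tt , isJoin-⊥ʳ (just (μ , rμ))
    where open BelowBinarySum μ α β f cf μ≐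
  ... | yes (a₀ , fa₀≡0) | yes (a₁ , fa₁≢0) =
    just y₁ , just z₁ ,
    factor-left retract-left retract-left-continuous (retract-left-hits-left fa₀≡0) ,
    factor-right retract-right retract-right-continuous
      (retract-right-hits-right fa₁≢0) ,
    precompose-≤ μ retract-left retract-left-continuous ,
    precompose-≤ μ retract-right retract-right-continuous ,
    least
    where
    open BelowBinarySum μ α β f cf μ≐
    open Retractions a₀ a₁
    y₁ z₁ : 𝓛* 𝒜
    y₁ = μ-left , precompose-rangeIn μ retract-left retract-left-continuous rμ
    z₁ = μ-right , precompose-rangeIn μ retract-right retract-right-continuous rμ
    least : ∀ w → just y₁ ⊑ w → just z₁ ⊑ w → just (μ , rμ) ⊑ w
    least (just w) = glue {proj₁ w}

  𝓛*⊥-distributive : ExcludedMiddle 0ℓ → IsDistributive _⊑_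
  𝓛*⊥-distributive em nothing y z j _ _ =
    nothing , nothing , tt , tt , isJoin-⊥ˡ nothing
  𝓛*⊥-distributive em (just x) nothing z j (_ , _ , least) x≤j =
    nothing , just x , tt , ≤⊥-trans (just x) j z x≤j (least z tt (≤⊥-refl z)) ,
    isJoin-⊥ˡ (just x)
  𝓛*⊥-distributive em (just x) (just y) nothing j (_ , _ , least) x≤j =
    just x , nothing ,
    ≤⊥-trans (just x) j (just y) x≤j (least (just y) (≤⊥-refl (just y)) tt) ,
    tt , isJoin-⊥ʳ (just x)
  𝓛*⊥-distributive em (just x) (just y) (just z) j (_ , _ , least) x≤j =
    split-below-⊕* em x y z
      (≤⊥-trans (just x) j (just (y ⊕* z)) x≤j (least (just (y ⊕* z)) y≤y⊕z z≤y⊕z))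
    where
    y≤y⊕z = proj₁ (⊕*-isJoin y z)
    z≤y⊕z = proj₁ (proj₂ (⊕*-isJoin y z))

proposition9p1 : ExcludedMiddle 0ℓ → (𝒜 : Family) → FamilyOfOpen 𝒜 →
    (IsUpperSemilattice (_≤L_ {𝒜}) × HasCountableSups (_≤L_ {𝒜}))
    × (IsUpperSemilattice (_≤⊥_ {𝒜}) × IsDistributive (_≤⊥_ {𝒜})
    × HasCountableSups (_≤⊥_ {𝒜}))
proposition9p1 em 𝒜 _ =
  (𝓛-join 𝒜 , 𝓛-sup 𝒜) ,
  (𝓛*⊥-join 𝒜 , 𝓛*⊥-distributive 𝒜 em , 𝓛*⊥-sup 𝒜 em)
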